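{- Let $P_n$ be the path on $n\geq 5$ vertices. Then $\mathrm{Hull}(P_n)$ is the complete bipartite graph whose two parts are the two colour classes of $P_n$, of sizes $\lceil n/2\rceil$ and $\lfloor n/2\rfloor$.
   Context: For a set $M$ of transformations of the vertex set $V$ (acting on the right), $\mathrm{Gr}(M)$ is the graph on $V$ in which distinct $v,w$ are adjacent iff no $f\in M$ satisfies $vf=wf$. The hull of a graph $X$ is $\mathrm{Hull}(X)=\mathrm{Gr}(\mathrm{End}(X))$, where $\mathrm{End}(X)$ is the endomorphism monoid of $X$. -}

module Defs where

open import Data.Nat using (ℕ; suc; _%_; _/_; _+_)
open import Data.Fin using (Fin; toℕ)
open import Data.Product using (Σ; _×_)
open import Data.Sum using (_⊎_)
open import Relation.Nullary using (¬_)
open import Relation.Binary.PropositionalEquality using (_≡_; _≢_)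

Graph : ℕ → Set₁
Graph n = Fin n → Fin n → Set

PathAdj : (n : ℕ) → Graph n
PathAdj n i j = (toℕ j ≡ suc (toℕ i)) ⊎ (toℕ i ≡ suc (toℕ j))

IsEndo : {n : ℕ} → Graph n → (Fin n → Fin n) → Set
IsEndo {n} X f = (v w : Fin n) → X v w → X (f v) (f w)

Gr : {n : ℕ} → ((Fin n → Fin n) → Set) → Graph n
Gr {n} M v w = (v ≢ w) × ¬ (Σ (Fin n → Fin n) (λ f → M f × (f v ≡ f w)))

Hull : {n : ℕ} → Graph n → Graph n
Hull X = Gr (IsEndo X)

-- Colour of a vertex of P_n in its (unique) proper 2-colouring: parity of index.
colour : {n : ℕ} → Fin n → ℕ
colour i = toℕ i % 2

countColour : (n : ℕ) → ℕ → ℕ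
countColour ℕ.zero c = 0
countColour (suc n) c with n % 2 Data.Nat.≟ c
... | Relation.Nullary.yes _ = suc (countColour n c)
... | Relation.Nullary.no _ = countColour n c

module Submission where

-- We work with the parity homomorphism ℕ → ℤ/2 of the standard library.
-- (1) P_n is bipartite: adjacent vertices have opposite parity, and P_n is
--     connected: a function constant along edges is constant.
-- (2) Hence for every endomorphism f the "parity shift" parity(f i) + parity i
--     is constant, so f can identify only vertices of equal parity; vertices
--     of different parity are therefore adjacent in the hull.
-- (3) Conversely, folding P_n onto its first edge (i ↦ vertex parity(i)) is
--     an endomorphism identifying any two vertices of equal parity, so such
--     vertices are never adjacent in the hull.
-- (4) Independently, the colour classes have sizes ⌈n/2⌉ and ⌊n/2⌋, since
--     each colour occurs exactly once among two consecutive indices.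
-- The theorem combines (2)–(4); the hypothesis n ≥ 5 is only used as n ≥ 2.

open import Defs
open import Data.Nat using (ℕ; _≤_; _/_; _+_; suc)
open import Data.Fin using (Fin)
open import Data.Product using (_×_)
open import Relation.Binary.PropositionalEquality using (_≡_; _≢_)
open import Function.Bundles using (_⇔_)

open import Data.Nat using (_%_; _≟_; parity; s≤s; z≤n)
open import Data.Nat.DivMod using (m/n≡1+[m∸n]/n)
open import Data.Fin using (toℕ; inject₁) renaming (zero to fzero; suc to fsuc)
open import Data.Fin.Properties using (toℕ-inject₁)
open import Data.Fin.Induction using (<-weakInduction)
open import Data.Parity.Base as ℙ using (Parity; 0ℙ; 1ℙ; _⁻¹)
open import Data.Parity.Properties
  using (suc-homo-⁻¹; ⁻¹-selfInverse; +-cancelˡ-≡)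
open import Data.Product using (_,_)
open import Data.Sum using (_⊎_; inj₁; inj₂)
open import Relation.Nullary using (yes; no; contradiction)
open import Relation.Binary.PropositionalEquality
  using (refl; sym; trans; cong; cong₂; module ≡-Reasoning)
open import Function.Bundles using (mk⇔; Equivalence)

open ≡-Reasoning

parityValue : Parity → ℕ
parityValue 0ℙ = 0
parityValue 1ℙ = 1

%2≡parityValue : ∀ m → m % 2 ≡ parityValue (parity m)
%2≡parityValue 0 = refl
%2≡parityValue 1 = refl
%2≡parityValue (suc (suc m)) = %2≡parityValue m

sameColour⇔sameParity : ∀ {n} (v w : Fin n) →
  colour v ≡ colour w ⇔ parity (toℕ v) ≡ parity (toℕ w)
sameColour⇔sameParity v w = mk⇔ to from
  where
    parityValue-injective : ∀ {p q} → parityValue p ≡ parityValue q → p ≡ q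
    parityValue-injective {0ℙ} {0ℙ} _ = refl
    parityValue-injective {1ℙ} {1ℙ} _ = refl

    to : colour v ≡ colour w → parity (toℕ v) ≡ parity (toℕ w)
    to c = parityValue-injective (begin
      parityValue (parity (toℕ v)) ≡⟨ sym (%2≡parityValue (toℕ v)) ⟩
      colour v                     ≡⟨ c ⟩
      colour w                     ≡⟨ %2≡parityValue (toℕ w) ⟩
      parityValue (parity (toℕ w)) ∎)

    from : parity (toℕ v) ≡ parity (toℕ w) → colour v ≡ colour w
    from p = begin
      colour v                     ≡⟨ %2≡parityValue (toℕ v) ⟩
      parityValue (parity (toℕ v)) ≡⟨ cong parityValue p ⟩
      parityValue (parity (toℕ w)) ≡⟨ sym (%2≡parityValue (toℕ w)) ⟩
      colour w                     ∎

adjacent⇒oppositeParity : ∀ {n} {i j : Fin n} → PathAdj n i j →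
  parity (toℕ j) ≡ parity (toℕ i) ⁻¹
adjacent⇒oppositeParity {i = i} (inj₁ j≡1+i) =
  trans (cong parity j≡1+i) (sym (⁻¹-selfInverse (suc-homo-⁻¹ (toℕ i))))
adjacent⇒oppositeParity {j = j} (inj₂ i≡1+j) =
  trans (sym (suc-homo-⁻¹ (toℕ j))) (cong (λ k → parity k ⁻¹) (sym i≡1+j))

edgeConstant⇒constant : ∀ {n} {A : Set} (g : Fin n → A) →
  (∀ i j → PathAdj n i j → g i ≡ g j) → ∀ v w → g v ≡ g w
edgeConstant⇒constant {suc m} g edge v w = trans (toZero v) (sym (toZero w))
  where
    predecessorEdge : ∀ i → g (inject₁ i) ≡ g (fsuc i)
    predecessorEdge i = edge (inject₁ i) (fsuc i) (inj₁ (cong suc (sym (toℕ-inject₁ i))))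

    toZero : ∀ v → g v ≡ g fzero
    toZero = <-weakInduction (λ v → g v ≡ g fzero) refl
      (λ i ih → trans (sym (predecessorEdge i)) ih)

⁻¹+⁻¹ : ∀ p q → p ⁻¹ ℙ.+ q ⁻¹ ≡ p ℙ.+ q
⁻¹+⁻¹ 0ℙ 0ℙ = refl
⁻¹+⁻¹ 0ℙ 1ℙ = refl
⁻¹+⁻¹ 1ℙ 0ℙ = refl
⁻¹+⁻¹ 1ℙ 1ℙ = refl

parityShift : ∀ {n} → (Fin n → Fin n) → Fin n → Parity
parityShift f i = parity (toℕ (f i)) ℙ.+ parity (toℕ i)

endo⇒parityShiftConstant : ∀ {n} (f : Fin n → Fin n) → IsEndo (PathAdj n) f →
  ∀ v w → parityShift f v ≡ parityShift f w
endo⇒parityShiftConstant {n} f endo = edgeConstant⇒constant (parityShift f) shiftAlongEdge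
  where
    shiftAlongEdge : ∀ i j → PathAdj n i j → parityShift f i ≡ parityShift f j
    shiftAlongEdge i j ij = sym (begin
      parity (toℕ (f j)) ℙ.+ parity (toℕ j)
        ≡⟨ cong₂ ℙ._+_ (adjacent⇒oppositeParity (endo i j ij)) (adjacent⇒oppositeParity ij) ⟩
      parity (toℕ (f i)) ⁻¹ ℙ.+ parity (toℕ i) ⁻¹
        ≡⟨ ⁻¹+⁻¹ (parity (toℕ (f i))) (parity (toℕ i)) ⟩
      parity (toℕ (f i)) ℙ.+ parity (toℕ i) ∎)

endoIdentifies⇒sameParity : ∀ {n} (f : Fin n → Fin n) → IsEndo (PathAdj n) f →
  ∀ v w → f v ≡ f w → parity (toℕ v) ≡ parity (toℕ w)
endoIdentifies⇒sameParity f endo v w fv≡fw =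
  +-cancelˡ-≡ (parity (toℕ (f w))) (parity (toℕ v)) (parity (toℕ w)) (begin
    parity (toℕ (f w)) ℙ.+ parity (toℕ v) ≡⟨ cong (λ u → parity (toℕ u) ℙ.+ parity (toℕ v)) (sym fv≡fw) ⟩
    parityShift f v                      ≡⟨ endo⇒parityShiftConstant f endo v w ⟩
    parityShift f w                      ∎)

edgeEnd : ∀ {m} → Parity → Fin (suc (suc m))
edgeEnd 0ℙ = fzero
edgeEnd 1ℙ = fsuc fzero

edgeEnd-adjacent : ∀ {m} p → PathAdj (suc (suc m)) (edgeEnd p) (edgeEnd (p ⁻¹))
edgeEnd-adjacent 0ℙ = inj₁ refl
edgeEnd-adjacent 1ℙ = inj₂ refl

fold : ∀ {m} → Fin (suc (suc m)) → Fin (suc (suc m))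
fold i = edgeEnd (parity (toℕ i))

fold-endo : ∀ {m} → IsEndo (PathAdj (suc (suc m))) fold
fold-endo i j ij rewrite adjacent⇒oppositeParity ij = edgeEnd-adjacent (parity (toℕ i))

hullOfPath : ∀ {m} (v w : Fin (suc (suc m))) →
  Hull (PathAdj (suc (suc m))) v w ⇔ (colour v ≢ colour w)
hullOfPath {m} v w = mk⇔ adjacent⇒differentColour differentColour⇒adjacent
  where
    sameParity⇔ : colour v ≡ colour w ⇔ parity (toℕ v) ≡ parity (toℕ w)
    sameParity⇔ = sameColour⇔sameParity v w

    adjacent⇒differentColour : Hull (PathAdj (suc (suc m))) v w → colour v ≢ colour w
    adjacent⇒differentColour (_ , noEndoIdentifies) sameColour =
      noEndoIdentifies (fold , fold-endo , cong edgeEnd (Equivalence.to sameParity⇔ sameColour))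

    differentColour⇒adjacent : colour v ≢ colour w → Hull (PathAdj (suc (suc m))) v w
    differentColour⇒adjacent differentColour =
        (λ v≡w → differentColour (cong colour v≡w))
      , (λ (f , endo , fv≡fw) →
           differentColour (Equivalence.from sameParity⇔ (endoIdentifies⇒sameParity f endo v w fv≡fw)))

countColour-suc-same : ∀ m {c} → m % 2 ≡ c → countColour (suc m) c ≡ suc (countColour m c)
countColour-suc-same m {c} m%2≡c with m % 2 ≟ c
... | yes _ = refl
... | no m%2≢c = contradiction m%2≡c m%2≢c

countColour-suc-other : ∀ m {c d} → m % 2 ≡ d → d ≢ c → countColour (suc m) c ≡ countColour m c
countColour-suc-other m {c} refl d≢c with m % 2 ≟ c
... | yes m%2≡c = contradiction m%2≡c d≢c
... | no _ = refl

consecutiveColours : ∀ m → (m % 2 ≡ 0 × suc m % 2 ≡ 1) ⊎ (m % 2 ≡ 1 × suc m % 2 ≡ 0)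
consecutiveColours 0 = inj₁ (refl , refl)
consecutiveColours 1 = inj₂ (refl , refl)
consecutiveColours (suc (suc m)) = consecutiveColours m

countColour-twoSteps : ∀ m c → c ≤ 1 → countColour (suc (suc m)) c ≡ suc (countColour m c)
countColour-twoSteps m c c≤1 with consecutiveColours m | c≤1
... | inj₁ (m↦0 , sm↦1) | z≤n =
  trans (countColour-suc-other (suc m) sm↦1 (λ ())) (countColour-suc-same m m↦0)
... | inj₁ (m↦0 , sm↦1) | s≤s z≤n =
  trans (countColour-suc-same (suc m) sm↦1) (cong suc (countColour-suc-other m m↦0 (λ ())))
... | inj₂ (m↦1 , sm↦0) | z≤n =
  trans (countColour-suc-same (suc m) sm↦0) (cong suc (countColour-suc-other m m↦1 (λ ())))
... | inj₂ (m↦1 , sm↦0) | s≤s z≤n =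
  trans (countColour-suc-other (suc m) sm↦0 (λ ())) (countColour-suc-same m m↦1)

half-suc-suc : ∀ k → suc (suc k) / 2 ≡ suc (k / 2)
half-suc-suc k = m/n≡1+[m∸n]/n {suc (suc k)} {2} (s≤s (s≤s z≤n))

countColour0 : ∀ n → countColour n 0 ≡ (n + 1) / 2
countColour0 0 = refl
countColour0 1 = refl
countColour0 (suc (suc n)) = begin
  countColour (suc (suc n)) 0 ≡⟨ countColour-twoSteps n 0 z≤n ⟩
  suc (countColour n 0)       ≡⟨ cong suc (countColour0 n) ⟩
  suc ((n + 1) / 2)           ≡⟨ sym (half-suc-suc (n + 1)) ⟩
  (suc (suc n) + 1) / 2       ∎

countColour1 : ∀ n → countColour n 1 ≡ n / 2
countColour1 0 = refl
countColour1 1 = refl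
countColour1 (suc (suc n)) = begin
  countColour (suc (suc n)) 1 ≡⟨ countColour-twoSteps n 1 (s≤s z≤n) ⟩
  suc (countColour n 1)       ≡⟨ cong suc (countColour1 n) ⟩
  suc (n / 2)                 ≡⟨ sym (half-suc-suc n) ⟩
  suc (suc n) / 2             ∎

mainTheorem8 : (n : ℕ) → 5 ≤ n →
    ((v w : Fin n) → Hull (PathAdj n) v w ⇔ (colour v ≢ colour w))
    × (countColour n 0 ≡ (n + 1) / 2) × (countColour n 1 ≡ n / 2)
mainTheorem8 n@(suc (suc _)) (s≤s (s≤s _)) = hullOfPath , countColour0 n , countColour1 n
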